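{- For any $*$-term $P\wedge Q$ (with $P\in P^*$, $Q\in P^d$), the tree $se(P\wedge Q)$ has the unique conjunction decomposition $(se(P)[\mathsf T\mapsto\triangle],\,se(Q))$ and has no disjunction decomposition. For any $*$-term $P\vee Q$ (with $P\in P^*$, $Q\in P^c$), the tree $se(P\vee Q)$ has no conjunction decomposition and its unique disjunction decomposition is $(se(P)[\mathsf F\mapsto\triangle],\,se(Q))$.
   Context: Closed terms over constants $\mathsf T,\mathsf F$, atoms $a\in A$ ($A$ non-empty), unary $\neg$ and binary $\wedge,\vee$. Grammar (with $a\in A$): $P^{\mathsf T}::=\mathsf T\mid (a\wedge P^{\mathsf T})\vee P^{\mathsf T}$; $P^{\mathsf F}::=\mathsf F\mid (a\vee P^{\mathsf F})\wedge P^{\mathsf F}$; $\ell$-terms $P^\ell::=(a\wedge P^{\mathsf T})\vee P^{\mathsf F}\mid(\neg a\wedge P^{\mathsf T})\vee P^{\mathsf F}$; $*$-terms $P^*::=P^c\mid P^d$, $P^c::=P^\ell\mid P^*\wedge P^d$, $P^d::=P^\ell\mid P^*\vee P^c$. $\mathcal T_A$: least set containing $\mathsf T,\mathsf F$ and $X\trianglelefteq a\trianglerighteq Y$ for $X,Y\in\mathcal T_A$, $a\in A$; $\mathcal T_{A,\triangle}$ likewise with leaves in $\{\mathsf T,\mathsf F,\triangle\}$. Depth: $d(\mathsf T)=d(\mathsf F)=0$, $d(Y\trianglelefteq a\trianglerighteq Z)=1+\max(d(Y),d(Z))$. Leaf replacement $X[\ell_1\mapsto Y_1,\dots]$ replaces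 every leaf $\ell_i$ of $X$ by $Y_i$. $se(\mathsf T)=\mathsf T$, $se(\mathsf F)=\mathsf F$, $se(a)=\mathsf T\trianglelefteq a\trianglerighteq\mathsf F$, $se(\neg P)=se(P)[\mathsf T\mapsto\mathsf F,\mathsf F\mapsto\mathsf T]$, $se(P\wedge Q)=se(P)[\mathsf T\mapsto se(Q)]$, $se(P\vee Q)=se(P)[\mathsf F\mapsto se(Q)]$. A pair $(Y,Z)\in\mathcal T_{A,\triangle}\times\mathcal T_A$ is a candidate conjunction decomposition (ccd) of $X\in\mathcal T_A$ if $X=Y[\triangle\mapsto Z]$, $Y$ contains $\triangle$, $Y$ contains $\mathsf F$ but not $\mathsf T$, and $Z$ contains both $\mathsf T$ and $\mathsf F$; it is a candidate disjunction decomposition (cdd) if the same holds with "$Y$ contains $\mathsf T$ but not $\mathsf F$" instead. A conjunction decomposition (cd) of $X$ is a ccd $(Y,Z)$ of $X$ such that no other ccd $(Y',Z')$ of $X$ has $d(Z')<d(Z)$; a disjunction decomposition (dd) is a cdd $(Y,Z)$ of $X$ such that no other cdd $(Y',Z')$ of $X$ has $d(Z')<d(Z)$. -}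

module Defs where

open import Data.Nat using (ℕ; zero; suc; _⊔_; _<_)
open import Data.Product using (_×_; Σ; _,_; ∃)
open import Relation.Binary.PropositionalEquality using (_≡_)
open import Relation.Nullary using (¬_)

module _ (A : Set) where

  data Term : Set where
    `T `F : Term
    at   : A → Term
    `¬_  : Term → Term
    _`∧_ _`∨_ : Term → Term → Term

  data IsPT : Term → Set where
    pT  : IsPT `T
    pTs : ∀ {a P Q} → IsPT P → IsPT Q → IsPT ((at a `∧ P) `∨ Q)

  data IsPF : Term → Set where
    pF  : IsPF `F
    pFs : ∀ {a P Q} → IsPF P → IsPF Q → IsPF ((at a `∨ P) `∧ Q)

  data IsPℓ : Term → Set where
    pos : ∀ {a P Q} → IsPT P → IsPF Q → IsPℓ ((at a `∧ P) `∨ Q)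
    neg : ∀ {a P Q} → IsPT P → IsPF Q → IsPℓ (((`¬ at a) `∧ P) `∨ Q)

  data IsP* : Term → Set
  data IsPc : Term → Set
  data IsPd : Term → Set

  data IsP* where
    c : ∀ {P} → IsPc P → IsP* P
    d : ∀ {P} → IsPd P → IsP* P

  data IsPc where
    ℓ   : ∀ {P} → IsPℓ P → IsPc P
    and : ∀ {P Q} → IsP* P → IsPd Q → IsPc (P `∧ Q)

  data IsPd where
    ℓ  : ∀ {P} → IsPℓ P → IsPd P
    or : ∀ {P Q} → IsP* P → IsPc Q → IsPd (P `∨ Q)

data Leaf : Set where
  lT lF : Leaf

data Leaf△ : Set where
  lT lF l△ : Leaf△

-- binary trees X ⊴ a ⊵ Y with leaves in L
data Tree (A L : Set) : Set where
  leaf : L → Tree A L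
  node : Tree A L → A → Tree A L → Tree A L

module _ {A : Set} where

  𝒯 : Set
  𝒯 = Tree A Leaf

  𝒯△ : Set
  𝒯△ = Tree A Leaf△

  depth : ∀ {L} → Tree A L → ℕ
  depth (leaf _) = 0
  depth (node Y a Z) = suc (depth Y ⊔ depth Z)

  replace : ∀ {L M} → Tree A L → (L → Tree A M) → Tree A M
  replace (leaf l) f = f l
  replace (node Y a Z) f = node (replace Y f) a (replace Z f)

  repl : ∀ {M} → 𝒯 → Tree A M → Tree A M → Tree A M
  repl X Y Z = replace X λ { lT → Y ; lF → Z }

  T𝒯 F𝒯 : 𝒯
  T𝒯 = leaf lT
  F𝒯 = leaf lF

  plug : 𝒯△ → 𝒯 → 𝒯
  plug Y Z = replace Y λ { lT → T𝒯 ; lF → F𝒯 ; l△ → Z }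

  emb : Leaf → 𝒯△
  emb lT = leaf lT
  emb lF = leaf lF

  T↦△ : 𝒯 → 𝒯△
  T↦△ X = repl X (leaf l△) (leaf lF)

  F↦△ : 𝒯 → 𝒯△
  F↦△ X = repl X (leaf lT) (leaf l△)

  se : Term A → 𝒯
  se `T = T𝒯
  se `F = F𝒯
  se (at a) = node T𝒯 a F𝒯
  se (`¬ P) = repl (se P) F𝒯 T𝒯
  se (P `∧ Q) = repl (se P) (se Q) F𝒯
  se (P `∨ Q) = repl (se P) T𝒯 (se Q)

  data _∈L_ {L : Set} (l : L) : Tree A L → Set where
    here  : l ∈L leaf l
    left  : ∀ {Y a Z} → l ∈L Y → l ∈L node Y a Z
    right : ∀ {Y a Z} → l ∈L Z → l ∈L node Y a Z

  IsCCD : 𝒯 → 𝒯△ → 𝒯 → Set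
  IsCCD X Y Z = (X ≡ plug Y Z) × (l△ ∈L Y) × (lF ∈L Y) × ¬ (lT ∈L Y)
                × (lT ∈L Z) × (lF ∈L Z)

  IsCDD : 𝒯 → 𝒯△ → 𝒯 → Set
  IsCDD X Y Z = (X ≡ plug Y Z) × (l△ ∈L Y) × (lT ∈L Y) × ¬ (lF ∈L Y)
                × (lT ∈L Z) × (lF ∈L Z)

  IsCD : 𝒯 → 𝒯△ → 𝒯 → Set
  IsCD X Y Z = IsCCD X Y Z × (∀ Y' Z' → IsCCD X Y' Z' → ¬ (depth Z' < depth Z))

  IsDD : 𝒯 → 𝒯△ → 𝒯 → Set
  IsDD X Y Z = IsCDD X Y Z × (∀ Y' Z' → IsCDD X Y' Z' → ¬ (depth Z' < depth Z))

  UniqueCD : 𝒯 → 𝒯△ → 𝒯 → Set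
  UniqueCD X Y Z = IsCD X Y Z × (∀ Y' Z' → IsCD X Y' Z' → (Y' ≡ Y) × (Z' ≡ Z))

  UniqueDD : 𝒯 → 𝒯△ → 𝒯 → Set
  UniqueDD X Y Z = IsDD X Y Z × (∀ Y' Z' → IsDD X Y' Z' → (Y' ≡ Y) × (Z' ≡ Z))

  NoCD : 𝒯 → Set
  NoCD X = ∀ Y Z → ¬ IsCD X Y Z

  NoDD : 𝒯 → Set
  NoDD X = ∀ Y Z → ¬ IsDD X Y Z

-- Write X [ t ↦ Q ] for X with every t-leaf replaced by Q, so that se (P ∧ Q) is
-- se P [ T ↦ se Q ] and se (P ∨ Q) is se P [ F ↦ se Q ].  Call Q t-rigid if it is
-- Y[△ ↦ Z] with t ∉ Y and T, F ∈ Z only for Y = △.  For t-rigid Q, comparing any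
-- such splitting of P [ t ↦ Q ] with P [ t ↦ △ ] along a path to a t-leaf of P
-- shows that its inner tree is either Q or strictly deeper than Q; an inner tree
-- deeper than Q is again of the form U [ t ↦ Q ] and leaves no t in the context.
-- This gives the unique decomposition of the first kind and none of the second.
-- Rigidity of the trees of *-terms is proved along the grammar: the two subtrees
-- of an ℓ-term carry one leaf colour each, and P [ s ↦ Q ] inherits rigidity for
-- the other leaf from the rigidity of P by the same depth argument.
module Submission where

open import Defs
open import Data.Empty using (⊥; ⊥-elim)
open import Data.Nat using (_≤_; _<_; s≤s; z≤n)
open import Data.Nat.Properties
  using (≤-refl; ≤-reflexive; ≤-trans; <⇒≤; <⇒≱; ≮⇒≥; <-irrefl; m≤m⊔n; m≤n⊔m)
open import Data.Product using (∃; ∃₂; _×_; _,_; proj₁; proj₂)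
open import Data.Sum using (_⊎_; inj₁; inj₂)
open import Function using (_∘_)
open import Relation.Nullary using (¬_)
open import Relation.Binary.PropositionalEquality
  using (_≡_; refl; sym; trans; cong; cong₂; subst; subst₂; module ≡-Reasoning)

module _ {A : Set} where

  node-injectiveˡ : ∀ {L} {X X' Y Y' : Tree A L} {a b} → node X a Y ≡ node X' b Y' → X ≡ X'
  node-injectiveˡ refl = refl

  node-injectiveʳ : ∀ {L} {X X' Y Y' : Tree A L} {a b} → node X a Y ≡ node X' b Y' → Y ≡ Y'
  node-injectiveʳ refl = refl

  node-injective-label : ∀ {L} {X X' Y Y' : Tree A L} {a b} → node X a Y ≡ node X' b Y' → a ≡ b
  node-injective-label refl = refl

  _⊆L_ : ∀ {L} → Tree A L → Tree A L → Set
  Y ⊆L Y' = ∀ {l} → l ∈L Y → l ∈L Y'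

  replace-cong : ∀ {L M} (X : Tree A L) {f g : L → Tree A M} →
                 (∀ {l} → l ∈L X → f l ≡ g l) → replace X f ≡ replace X g
  replace-cong (leaf l) f≗g = f≗g here
  replace-cong (node X a Y) f≗g =
    cong₂ (λ U V → node U a V) (replace-cong X (f≗g ∘ left)) (replace-cong Y (f≗g ∘ right))

  replace-id : ∀ {L} (X : Tree A L) {f : L → Tree A L} → (∀ {l} → l ∈L X → f l ≡ leaf l) → replace X f ≡ X
  replace-id (leaf l) f≗leaf = f≗leaf here
  replace-id (node X a Y) f≗leaf =
    cong₂ (λ U V → node U a V) (replace-id X (f≗leaf ∘ left)) (replace-id Y (f≗leaf ∘ right))

  replace-replace : ∀ {L M N} (X : Tree A L) (f : L → Tree A M) (g : M → Tree A N) →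
                    replace (replace X f) g ≡ replace X (λ l → replace (f l) g)
  replace-replace (leaf l) f g = refl
  replace-replace (node X a Y) f g = cong₂ (λ U V → node U a V) (replace-replace X f g) (replace-replace Y f g)

  ∈-replace⁺ : ∀ {L M} {X : Tree A L} {f : L → Tree A M} {k l} → k ∈L X → l ∈L f k → l ∈L replace X f
  ∈-replace⁺ here m = m
  ∈-replace⁺ (left p) m = left (∈-replace⁺ p m)
  ∈-replace⁺ (right p) m = right (∈-replace⁺ p m)

  ∈-replace⁻ : ∀ {L M} (X : Tree A L) {f : L → Tree A M} {l} →
               l ∈L replace X f → ∃ λ k → k ∈L X × l ∈L f k
  ∈-replace⁻ (leaf k) m = k , here , m
  ∈-replace⁻ (node X a Y) (left m) = let k , p , m' = ∈-replace⁻ X m in k , left p , m'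
  ∈-replace⁻ (node X a Y) (right m) = let k , p , m' = ∈-replace⁻ Y m in k , right p , m'

  depth-replace : ∀ {L M} {X : Tree A L} {f : L → Tree A M} {k} → k ∈L X → depth (f k) ≤ depth (replace X f)
  depth-replace here = ≤-refl
  depth-replace (left p) = <⇒≤ (s≤s (≤-trans (depth-replace p) (m≤m⊔n _ _)))
  depth-replace (right p) = <⇒≤ (s≤s (≤-trans (depth-replace p) (m≤n⊔m _ _)))

  depth-replace-node : ∀ {L M} {X Y : Tree A L} {a} {f : L → Tree A M} {k} →
                       k ∈L node X a Y → depth (f k) < depth (replace (node X a Y) f)
  depth-replace-node (left p) = s≤s (≤-trans (depth-replace p) (m≤m⊔n _ _))
  depth-replace-node (right p) = s≤s (≤-trans (depth-replace p) (m≤n⊔m _ _))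

  other : Leaf → Leaf
  other lT = lF
  other lF = lT

  other-involutive : ∀ t → other (other t) ≡ t
  other-involutive lT = refl
  other-involutive lF = refl

  leaf-cases : ∀ u l → l ≡ u ⊎ l ≡ other u
  leaf-cases lT lT = inj₁ refl
  leaf-cases lT lF = inj₂ refl
  leaf-cases lF lT = inj₂ refl
  leaf-cases lF lF = inj₁ refl

  ⌜_⌝ : Leaf → Leaf△
  ⌜ lT ⌝ = lT
  ⌜ lF ⌝ = lF

  HasBoth : 𝒯 {A} → Set
  HasBoth Z = lT ∈L Z × lF ∈L Z

  ∈-both : ∀ {Z : 𝒯 {A}} → HasBoth Z → ∀ l → l ∈L Z
  ∈-both bothZ lT = proj₁ bothZ
  ∈-both bothZ lF = proj₂ bothZ

  both : ∀ u {Z : 𝒯 {A}} → u ∈L Z → other u ∈L Z → HasBoth Z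
  both lT p q = p , q
  both lF p q = q , p

  both-depth : ∀ {Z : 𝒯 {A}} → HasBoth Z → 0 < depth Z
  both-depth {leaf lT} (_ , ())
  both-depth {leaf lF} (() , _)
  both-depth {node _ _ _} _ = s≤s z≤n

  ∈-plug⁺ˡ : ∀ {Y : 𝒯△ {A}} {Z l} → ⌜ l ⌝ ∈L Y → l ∈L plug Y Z
  ∈-plug⁺ˡ {l = lT} p = ∈-replace⁺ p here
  ∈-plug⁺ˡ {l = lF} p = ∈-replace⁺ p here

  ∈-plug⁺ʳ : ∀ {Y : 𝒯△ {A}} {Z l} → l△ ∈L Y → l ∈L Z → l ∈L plug Y Z
  ∈-plug⁺ʳ = ∈-replace⁺

  ∈-plug-hole : ∀ {Y : 𝒯△ {A}} {Z l} → ¬ ⌜ l ⌝ ∈L Y → l ∈L plug Y Z → l△ ∈L Y × l ∈L Z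
  ∈-plug-hole {Y} ny m with ∈-replace⁻ Y m
  ... | lT , p , here = ⊥-elim (ny p)
  ... | lF , p , here = ⊥-elim (ny p)
  ... | l△ , p , m' = p , m'

  depth-plug : ∀ {Y : 𝒯△ {A}} {Z} → l△ ∈L Y → depth Z ≤ depth (plug Y Z)
  depth-plug = depth-replace

  plug-unit : ∀ (Y : 𝒯△ {A}) {Z t} → ¬ ⌜ t ⌝ ∈L Y → t ∈L Z → plug Y Z ≡ Z → Y ≡ leaf l△
  plug-unit Y {Z} ny tZ e with proj₁ (∈-plug-hole ny (subst (_ ∈L_) (sym e) tZ))
  plug-unit (leaf l△) ny tZ e | here = refl
  plug-unit (node Y₁ a Y₂) ny tZ e | △Y = ⊥-elim (<-irrefl (sym (cong depth e)) (depth-replace-node △Y))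

  plug-injective : ∀ (Y Y' : 𝒯△ {A}) {Z t} → ¬ ⌜ t ⌝ ∈L Y → ¬ ⌜ t ⌝ ∈L Y' → t ∈L Z →
                   plug Y Z ≡ plug Y' Z → Y ≡ Y'
  plug-injective (leaf l△) (leaf l△) _ _ _ _ = refl
  plug-injective (leaf lT) (leaf lT) _ _ _ _ = refl
  plug-injective (leaf lF) (leaf lF) _ _ _ _ = refl
  plug-injective (leaf l△) Y' _ ny' tZ e = sym (plug-unit Y' ny' tZ (sym e))
  plug-injective Y (leaf l△) ny _ tZ e = plug-unit Y ny tZ e
  plug-injective (leaf lT) (leaf lF) _ _ _ ()
  plug-injective (leaf lF) (leaf lT) _ _ _ ()
  plug-injective (leaf lT) (node _ _ _) _ _ _ ()
  plug-injective (leaf lF) (node _ _ _) _ _ _ ()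
  plug-injective (node _ _ _) (leaf lT) _ _ _ ()
  plug-injective (node _ _ _) (leaf lF) _ _ _ ()
  plug-injective (node Y₁ a Y₂) (node Y₁' b Y₂') ny ny' tZ e with node-injective-label e
  ... | refl = cong₂ (λ U V → node U a V)
    (plug-injective Y₁ Y₁' (ny ∘ left) (ny' ∘ left) tZ (node-injectiveˡ e))
    (plug-injective Y₂ Y₂' (ny ∘ right) (ny' ∘ right) tZ (node-injectiveʳ e))

  -- Walking down plug Y Z ≡ replace P f towards a k-leaf of P (resp. an m-leaf of Y),
  -- one meets either the hole of Y or the leaf of P first.
  align-leaf : ∀ {L} (Y : 𝒯△) (Z : 𝒯) (P : Tree A L) {f : L → 𝒯} {k} →
               plug Y Z ≡ replace P f → k ∈L P →
               (∃ λ P' → k ∈L P' × Z ≡ replace P' f) ⊎ (∃ λ Y' → Y' ⊆L Y × plug Y' Z ≡ f k)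
  align-leaf (leaf l△) Z P e p = inj₁ (P , p , e)
  align-leaf Y Z (leaf _) e here = inj₂ (Y , (λ m → m) , e)
  align-leaf (leaf lT) Z (node _ _ _) () p
  align-leaf (leaf lF) Z (node _ _ _) () p
  align-leaf (node Y₁ _ Y₂) Z (node P₁ _ P₂) e (left p) with align-leaf Y₁ Z P₁ (node-injectiveˡ e) p
  ... | inj₁ found = inj₁ found
  ... | inj₂ (Y' , Y'⊆Y₁ , e') = inj₂ (Y' , left ∘ Y'⊆Y₁ , e')
  align-leaf (node Y₁ _ Y₂) Z (node P₁ _ P₂) e (right p) with align-leaf Y₂ Z P₂ (node-injectiveʳ e) p
  ... | inj₁ found = inj₁ found
  ... | inj₂ (Y' , Y'⊆Y₂ , e') = inj₂ (Y' , right ∘ Y'⊆Y₂ , e')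

  align-hole : ∀ {L} (Y : 𝒯△) (Z : 𝒯) (P : Tree A L) {f : L → 𝒯} {m} →
               plug Y Z ≡ replace P f → m ∈L Y →
               (∃₂ λ k Y' → m ∈L Y' × Y' ⊆L Y × plug Y' Z ≡ f k) ⊎
               (∃ λ P' → plug (leaf m) Z ≡ replace P' f)
  align-hole Y Z (leaf k) e p = inj₁ (k , Y , p , (λ m → m) , e)
  align-hole (leaf _) Z P e here = inj₂ (P , e)
  align-hole (node Y₁ _ Y₂) Z (node P₁ _ P₂) e (left p) with align-hole Y₁ Z P₁ (node-injectiveˡ e) p
  ... | inj₁ (k , Y' , p' , Y'⊆Y₁ , e') = inj₁ (k , Y' , p' , left ∘ Y'⊆Y₁ , e')
  ... | inj₂ found = inj₂ found
  align-hole (node Y₁ _ Y₂) Z (node P₁ _ P₂) e (right p) with align-hole Y₂ Z P₂ (node-injectiveʳ e) p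
  ... | inj₁ (k , Y' , p' , Y'⊆Y₂ , e') = inj₁ (k , Y' , p' , right ∘ Y'⊆Y₂ , e')
  ... | inj₂ found = inj₂ found

  punch : Leaf → Leaf → Leaf△
  punch lT lT = l△
  punch lT lF = lF
  punch lF lT = lT
  punch lF lF = l△

  unpunch : Leaf → Leaf△ → Leaf
  unpunch t lT = lT
  unpunch t lF = lF
  unpunch t l△ = t

  unpunch-punch : ∀ t l → unpunch t (punch t l) ≡ l
  unpunch-punch lT lT = refl
  unpunch-punch lT lF = refl
  unpunch-punch lF lT = refl
  unpunch-punch lF lF = refl

  hole : Leaf → Leaf → 𝒯△ {A}
  hole t l = leaf (punch t l)

  graft : Leaf → 𝒯 {A} → Leaf → 𝒯 {A}
  graft t Q l = plug (hole t l) Q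

  infix 30 _[_↦△] _[_↦_]

  _[_↦△] : 𝒯 {A} → Leaf → 𝒯△ {A}
  P [ t ↦△] = replace P (hole t)

  _[_↦_] : 𝒯 {A} → Leaf → 𝒯 {A} → 𝒯 {A}
  P [ t ↦ Q ] = replace P (graft t Q)

  plug-hole : ∀ {t} (P : 𝒯) {Q} → plug (P [ t ↦△]) Q ≡ P [ t ↦ Q ]
  plug-hole {t} P = replace-replace P (hole t) _

  ∉-hole : ∀ {t} (P : 𝒯 {A}) → ¬ ⌜ t ⌝ ∈L P [ t ↦△]
  ∉-hole {t} P m with ∈-replace⁻ P m
  ∉-hole {lT} P m | lT , _ , ()
  ∉-hole {lT} P m | lF , _ , ()
  ∉-hole {lF} P m | lT , _ , ()
  ∉-hole {lF} P m | lF , _ , ()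

  △-∈-hole : ∀ {t} {P : 𝒯 {A}} → t ∈L P → l△ ∈L P [ t ↦△]
  △-∈-hole {lT} p = ∈-replace⁺ p here
  △-∈-hole {lF} p = ∈-replace⁺ p here

  other-∈-hole : ∀ {t} {P : 𝒯 {A}} → other t ∈L P → ⌜ other t ⌝ ∈L P [ t ↦△]
  other-∈-hole {lT} p = ∈-replace⁺ p here
  other-∈-hole {lF} p = ∈-replace⁺ p here

  hole-injective : ∀ {t} (P P' : 𝒯 {A}) → P [ t ↦△] ≡ P' [ t ↦△] → P ≡ P'
  hole-injective {t} P P' e = begin
    P                                          ≡⟨ sym (fill P) ⟩
    replace (P [ t ↦△]) (leaf ∘ unpunch t)   ≡⟨ cong (λ Y → replace Y (leaf ∘ unpunch t)) e ⟩
    replace (P' [ t ↦△]) (leaf ∘ unpunch t)  ≡⟨ fill P' ⟩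
    P'                                         ∎
    where
    open ≡-Reasoning
    fill : ∀ X → replace (X [ t ↦△]) (leaf ∘ unpunch t) ≡ X
    fill X = trans (replace-replace X (hole t) _) (replace-id X (λ {l} _ → cong leaf (unpunch-punch t l)))

  graft-self : ∀ t (Q : 𝒯 {A}) → graft t Q t ≡ Q
  graft-self lT Q = refl
  graft-self lF Q = refl

  other-∈-graft : ∀ t {Q : 𝒯 {A}} → other t ∈L graft t Q (other t)
  other-∈-graft lT = here
  other-∈-graft lF = here

  ∉-graft-other : ∀ t {Q : 𝒯 {A}} → ¬ t ∈L graft t Q (other t)
  ∉-graft-other lT ()
  ∉-graft-other lF ()

  depth-graft-leaf : ∀ t (Q : 𝒯 {A}) k → depth (graft t Q k) ≤ depth Q
  depth-graft-leaf lT Q lT = ≤-refl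
  depth-graft-leaf lT Q lF = z≤n
  depth-graft-leaf lF Q lT = z≤n
  depth-graft-leaf lF Q lF = ≤-refl

  ⊆-graft : ∀ {t} {P Q : 𝒯 {A}} → t ∈L P → Q ⊆L P [ t ↦ Q ]
  ⊆-graft {t} {Q = Q} tP m = ∈-replace⁺ tP (subst (_ ∈L_) (sym (graft-self t Q)) m)

  ∈-graft-self : ∀ {t} (P : 𝒯 {A}) {Q} → t ∈L P [ t ↦ Q ] → t ∈L P
  ∈-graft-self {t} P m with ∈-replace⁻ P m
  ... | k , kP , m' with leaf-cases t k
  ...   | inj₁ refl = kP
  ...   | inj₂ refl = ⊥-elim (∉-graft-other t m')

  graft-both : ∀ {t} {P Q : 𝒯 {A}} → HasBoth P → HasBoth Q → HasBoth (P [ t ↦ Q ])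
  graft-both {t} bothP (qT , qF) = ⊆-graft (∈-both bothP t) qT , ⊆-graft (∈-both bothP t) qF

  graft-injective : ∀ {t} {Q : 𝒯 {A}} (P P' : 𝒯) → t ∈L Q → P [ t ↦ Q ] ≡ P' [ t ↦ Q ] → P ≡ P'
  graft-injective P P' tQ e = hole-injective P P'
    (plug-injective (P [ _ ↦△]) (P' [ _ ↦△]) (∉-hole P) (∉-hole P') tQ
      (trans (plug-hole P) (trans e (sym (plug-hole P')))))

  plug-graft : ∀ (Y : 𝒯△ {A}) {U W t} → (∀ l → ¬ ⌜ l ⌝ ∈L Y) →
               plug Y (U [ t ↦ W ]) ≡ (plug Y U) [ t ↦ W ]
  plug-graft Y noLeaf = sym (trans (replace-replace Y _ _) (replace-cong Y holeOnly))
    where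
    holeOnly : ∀ {k} → k ∈L Y → _
    holeOnly {lT} m = ⊥-elim (noLeaf lT m)
    holeOnly {lF} m = ⊥-elim (noLeaf lF m)
    holeOnly {l△} m = refl

  depth-graft : ∀ {t} {P Q : 𝒯 {A}} → t ∈L P → depth Q ≤ depth (P [ t ↦ Q ])
  depth-graft {t} {P} {Q} tP = subst (λ W → depth W ≤ depth (P [ t ↦ Q ])) (graft-self t Q) (depth-replace tP)

  depth-graft-node : ∀ {t} {P₁ P₂ Q : 𝒯 {A}} {a} → t ∈L node P₁ a P₂ →
                     depth Q < depth (node P₁ a P₂ [ t ↦ Q ])
  depth-graft-node {t} {P₁} {P₂} {Q} {a} tP =
    subst (λ W → depth W < depth (node P₁ a P₂ [ t ↦ Q ])) (graft-self t Q) (depth-replace-node tP)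

  depth-graft-strict : ∀ {t} (P : 𝒯 {A}) {Q} → t ∈L P → other t ∈L P → depth Q < depth (P [ t ↦ Q ])
  depth-graft-strict {lT} (leaf _) here ()
  depth-graft-strict {lF} (leaf _) here ()
  depth-graft-strict (node _ _ _) tP _ = depth-graft-node tP


  -- Rigid lT X: the only splitting of X whose context avoids T is the trivial one;
  -- in particular X has no ccd.
  Rigid : Leaf → 𝒯 {A} → Set
  Rigid t X = ∀ Y Z → plug Y Z ≡ X → ¬ ⌜ t ⌝ ∈L Y → HasBoth Z → Y ≡ leaf l△

  module _ {t : Leaf} {Q : 𝒯 {A}} where

    rigid-inner-≡ : ∀ (Y : 𝒯△) (P : 𝒯) {Z} → Rigid t Q → HasBoth Z → depth Z ≤ depth Q →
                    plug Y Z ≡ P [ t ↦ Q ] → ¬ ⌜ t ⌝ ∈L Y → t ∈L P → Z ≡ Q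
    rigid-inner-≡ Y P {Z} rigidQ bothZ shallow e ny tP with align-leaf Y Z P e tP
    ... | inj₁ (leaf _ , here , e') = trans e' (graft-self t Q)
    ... | inj₁ (node _ _ _ , tP' , e') =
      ⊥-elim (<⇒≱ (subst (depth Q <_) (cong depth (sym e')) (depth-graft-node tP')) shallow)
    ... | inj₂ (Y' , Y'⊆Y , e') with rigidQ Y' Z (trans e' (graft-self t Q)) (ny ∘ Y'⊆Y) bothZ
    ...   | refl = trans e' (graft-self t Q)

    context-≡-hole : ∀ (Y : 𝒯△) (P : 𝒯) → t ∈L Q → plug Y Q ≡ P [ t ↦ Q ] → ¬ ⌜ t ⌝ ∈L Y →
                     Y ≡ P [ t ↦△]
    context-≡-hole Y P tQ e ny = plug-injective Y (P [ t ↦△]) ny (∉-hole P) tQ (trans e (sym (plug-hole P)))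

    inner-deeper : ∀ (Y : 𝒯△) (P : 𝒯) {Z} → HasBoth Z → plug Y Z ≡ P [ t ↦ Q ] →
                   ¬ ⌜ other t ⌝ ∈L Y → other t ∈L P → depth Q < depth Z
    inner-deeper Y P {Z} bothZ e ny oP with align-leaf Y Z P e oP
    ... | inj₁ (P' , oP' , e') =
      subst (depth Q <_) (cong depth (sym e'))
        (depth-graft-strict P' (∈-graft-self P' (subst (t ∈L_) e' (∈-both bothZ t))) oP')
    ... | inj₂ (Y' , Y'⊆Y , e') =
      ⊥-elim (∉-graft-other t (subst (t ∈L_) e' (∈-plug⁺ʳ △Y' (∈-both bothZ t))))
      where
      △Y' : l△ ∈L Y'
      △Y' = proj₁ (∈-plug-hole (ny ∘ Y'⊆Y) (subst (other t ∈L_) (sym e') (other-∈-graft t)))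

    deep-inner-context-avoids : ∀ (Y : 𝒯△) (P : 𝒯) {Z} → HasBoth Q → depth Q < depth Z →
                                plug Y Z ≡ P [ t ↦ Q ] → ¬ ⌜ other t ⌝ ∈L Y → ¬ ⌜ t ⌝ ∈L Y
    deep-inner-context-avoids Y P {Z} bothQ deeper e ny tY with align-hole Y Z P e tY
    ... | inj₂ (P' , e') = <⇒≱ (both-depth bothQ) (subst (depth Q ≤_) (cong depth (sym leaf≡)) (depth-graft tP'))
      where
      leaf≡ : leaf t ≡ P' [ t ↦ Q ]
      leaf≡ = trans (sym (plug-⌜⌝ t)) e'
        where
        plug-⌜⌝ : ∀ l → plug (leaf ⌜ l ⌝) Z ≡ leaf l
        plug-⌜⌝ lT = refl
        plug-⌜⌝ lF = refl
      tP' : t ∈L P'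
      tP' = ∈-graft-self P' (subst (t ∈L_) leaf≡ here)
    ... | inj₁ (k , Y' , tY' , Y'⊆Y , e') with leaf-cases t k
    ...   | inj₂ refl = ∉-graft-other t (subst (t ∈L_) e' (∈-plug⁺ˡ tY'))
    ...   | inj₁ refl = <⇒≱ deeper (≤-trans (depth-plug △Y') (≤-reflexive (cong depth Y'Z≡Q)))
      where
      Y'Z≡Q : plug Y' Z ≡ Q
      Y'Z≡Q = trans e' (graft-self t Q)
      △Y' : l△ ∈L Y'
      △Y' = proj₁ (∈-plug-hole (ny ∘ Y'⊆Y) (subst (other t ∈L_) (sym Y'Z≡Q) (∈-both bothQ (other t))))

    deep-inner-is-graft : ∀ (Y : 𝒯△) (P : 𝒯) {Z} → depth Q < depth Z → plug Y Z ≡ P [ t ↦ Q ] →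
                          l△ ∈L Y → ∃ λ U → Z ≡ U [ t ↦ Q ]
    deep-inner-is-graft Y P {Z} deeper e △Y with align-hole Y Z P e △Y
    ... | inj₁ (k , Y' , △Y' , _ , e') =
      ⊥-elim (<⇒≱ deeper (≤-trans (depth-plug △Y')
        (subst (_≤ depth Q) (cong depth (sym e')) (depth-graft-leaf t Q k))))
    ... | inj₂ found = found

  rigid-graft : ∀ {u} s {X W : 𝒯 {A}} → Rigid u X → HasBoth X → HasBoth W → Rigid (other s) (X [ s ↦ W ])
  rigid-graft {u} s {X} {W} rigidX bothX bothW Y Z e ny bothZ = rigidX Y U plugYU≡X (avoids u) bothU
    where
    △Y : l△ ∈L Y
    △Y = proj₁ (∈-plug-hole ny (subst (other s ∈L_) (sym e) (⊆-graft (∈-both bothX s) (∈-both bothW (other s)))))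
    deeper : depth W < depth Z
    deeper = inner-deeper Y X bothZ e ny (∈-both bothX (other s))
    U : 𝒯
    U = proj₁ (deep-inner-is-graft Y X deeper e △Y)
    Z≡U[s↦W] : Z ≡ U [ s ↦ W ]
    Z≡U[s↦W] = proj₂ (deep-inner-is-graft Y X deeper e △Y)
    avoids : ∀ l → ¬ ⌜ l ⌝ ∈L Y
    avoids l with leaf-cases s l
    ... | inj₁ refl = deep-inner-context-avoids Y X bothW deeper e ny
    ... | inj₂ refl = ny
    plugYU≡X : plug Y U ≡ X
    plugYU≡X = graft-injective (plug Y U) X (∈-both bothW s) (begin
      plug Y U [ s ↦ W ]    ≡⟨ sym (plug-graft Y {U} {W} {s} avoids) ⟩
      plug Y (U [ s ↦ W ])  ≡⟨ cong (plug Y) (sym Z≡U[s↦W]) ⟩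
      plug Y Z              ≡⟨ e ⟩
      X [ s ↦ W ]           ∎)
      where open ≡-Reasoning
    bothU : HasBoth U
    bothU = let inU l = proj₂ (∈-plug-hole (avoids l) (subst (l ∈L_) (sym plugYU≡X) (∈-both bothX l)))
            in inU lT , inU lF

  -- Candidate lT and Candidate lF unfold to IsCCD and IsCDD.
  Candidate : Leaf → 𝒯 {A} → 𝒯△ {A} → 𝒯 {A} → Set
  Candidate t X Y Z = (X ≡ plug Y Z) × (l△ ∈L Y) × (⌜ other t ⌝ ∈L Y) × ¬ (⌜ t ⌝ ∈L Y) × HasBoth Z

  Decomposition : Leaf → 𝒯 {A} → 𝒯△ {A} → 𝒯 {A} → Set
  Decomposition t X Y Z = Candidate t X Y Z × (∀ Y' Z' → Candidate t X Y' Z' → ¬ (depth Z' < depth Z))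

  UniqueDecomposition : Leaf → 𝒯 {A} → 𝒯△ {A} → 𝒯 {A} → Set
  UniqueDecomposition t X Y Z =
    Decomposition t X Y Z × (∀ Y' Z' → Decomposition t X Y' Z' → (Y' ≡ Y) × (Z' ≡ Z))

  NoDecomposition : Leaf → 𝒯 {A} → Set
  NoDecomposition t X = ∀ Y Z → ¬ Decomposition t X Y Z

  module _ {t} {P Q : 𝒯 {A}} (bothP : HasBoth P) (bothQ : HasBoth Q) (rigidQ : Rigid t Q) where

    graft-candidate : Candidate t (P [ t ↦ Q ]) (P [ t ↦△]) Q
    graft-candidate = sym (plug-hole P) , △-∈-hole (∈-both bothP t) , other-∈-hole (∈-both bothP (other t)) ,
                      ∉-hole P , bothQ

    candidate-≡ : ∀ {Y Z} → Candidate t (P [ t ↦ Q ]) Y Z → depth Z ≤ depth Q →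
                  (Y ≡ P [ t ↦△]) × (Z ≡ Q)
    candidate-≡ {Y} (e , _ , _ , ny , bothZ) shallow
      with rigid-inner-≡ Y P rigidQ bothZ shallow (sym e) ny (∈-both bothP t)
    ... | refl = context-≡-hole Y P (∈-both bothQ t) (sym e) ny , refl

    graft-unique-decomposition : UniqueDecomposition t (P [ t ↦ Q ]) (P [ t ↦△]) Q
    graft-unique-decomposition = (graft-candidate , minimal) , unique
      where
      minimal : ∀ Y Z → Candidate t (P [ t ↦ Q ]) Y Z → ¬ (depth Z < depth Q)
      minimal Y Z cand shallower = <-irrefl (cong depth (proj₂ (candidate-≡ cand (<⇒≤ shallower)))) shallower
      unique : ∀ Y Z → Decomposition t (P [ t ↦ Q ]) Y Z → (Y ≡ P [ t ↦△]) × (Z ≡ Q)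
      unique Y Z (cand , minimalZ) = candidate-≡ cand (≮⇒≥ (minimalZ _ _ graft-candidate))

    graft-no-other-decomposition : NoDecomposition (other t) (P [ t ↦ Q ])
    graft-no-other-decomposition Y Z ((e , _ , tY , ny , bothZ) , _) =
      deep-inner-context-avoids Y P bothQ (inner-deeper Y P bothZ (sym e) ny (∈-both bothP (other t))) (sym e) ny
        (subst (λ l → ⌜ l ⌝ ∈L Y) (other-involutive t) tY)

  se-∧ : ∀ (P Q : Term A) → se (P `∧ Q) ≡ se P [ lT ↦ se Q ]
  se-∧ P Q = replace-cong (se P) λ { {lT} _ → refl ; {lF} _ → refl }

  se-∨ : ∀ (P Q : Term A) → se (P `∨ Q) ≡ se P [ lF ↦ se Q ]
  se-∨ P Q = replace-cong (se P) λ { {lT} _ → refl ; {lF} _ → refl }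

  T↦△-hole : ∀ (X : 𝒯 {A}) → T↦△ X ≡ X [ lT ↦△]
  T↦△-hole X = replace-cong X λ { {lT} _ → refl ; {lF} _ → refl }

  F↦△-hole : ∀ (X : 𝒯 {A}) → F↦△ X ≡ X [ lF ↦△]
  F↦△-hole X = replace-cong X λ { {lT} _ → refl ; {lF} _ → refl }

  repl-without-lF : ∀ (X : 𝒯 {A}) {W} → ¬ lF ∈L X → repl X T𝒯 W ≡ X
  repl-without-lF X noF = replace-id X λ { {lT} _ → refl ; {lF} m → ⊥-elim (noF m) }

  repl-without-lT : ∀ (X : 𝒯 {A}) {W} → ¬ lT ∈L X → repl X W F𝒯 ≡ X
  repl-without-lT X noT = replace-id X λ { {lT} m → ⊥-elim (noT m) ; {lF} _ → refl }

  Monochrome : Leaf → 𝒯 {A} → Set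
  Monochrome u X = u ∈L X × ¬ (other u ∈L X)

  monochrome-node : ∀ {u} {L R : 𝒯 {A}} {a} → Monochrome u L → Monochrome u R → Monochrome u (node L a R)
  monochrome-node (uL , noL) (_ , noR) = left uL , λ { (left m) → noL m ; (right m) → noR m }

  monochrome-unsplittable : ∀ {t} {C : 𝒯 {A}} Y {Z} → Monochrome t C → plug Y Z ≡ C →
                            ¬ ⌜ t ⌝ ∈L Y → HasBoth Z → ⊥
  monochrome-unsplittable {t} Y (tC , noC) e ny bothZ =
    noC (subst (other t ∈L_) e (∈-plug⁺ʳ △Y (∈-both bothZ (other t))))
    where
    △Y : l△ ∈L Y
    △Y = proj₁ (∈-plug-hole ny (subst (t ∈L_) (sym e) tC))

  data Bicoloured : 𝒯 {A} → Set where
    bicoloured : ∀ {u L a R} → Monochrome u L → Monochrome (other u) R → Bicoloured (node L a R)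

  bicoloured-both : ∀ {X} → Bicoloured X → HasBoth X
  bicoloured-both (bicoloured {u} (uL , _) (oR , _)) = both u (left uL) (right oR)

  bicoloured-rigid : ∀ {X} → Bicoloured X → ∀ t → Rigid t X
  bicoloured-rigid _ t (leaf l△) Z e ny bothZ = refl
  bicoloured-rigid (bicoloured _ _) t (leaf lT) Z () ny bothZ
  bicoloured-rigid (bicoloured _ _) t (leaf lF) Z () ny bothZ
  bicoloured-rigid (bicoloured {u} monoL monoR) t (node Y₁ _ Y₂) Z e ny bothZ with leaf-cases u t
  ... | inj₁ refl = ⊥-elim (monochrome-unsplittable Y₁ monoL (node-injectiveˡ e) (ny ∘ left) bothZ)
  ... | inj₂ refl = ⊥-elim (monochrome-unsplittable Y₂ monoR (node-injectiveʳ e) (ny ∘ right) bothZ)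

  PT-monochrome : ∀ {P} → IsPT A P → Monochrome lT (se P)
  PT-monochrome pT = here , λ ()
  PT-monochrome (pTs {a} {P} {Q} p q) =
    subst (λ L → Monochrome lT (node L a (se Q))) (sym (repl-without-lF (se P) (proj₂ (PT-monochrome p))))
      (monochrome-node (PT-monochrome p) (PT-monochrome q))

  PF-monochrome : ∀ {P} → IsPF A P → Monochrome lF (se P)
  PF-monochrome pF = here , λ ()
  PF-monochrome (pFs {a} {P} {Q} p q) =
    subst (λ R → Monochrome lF (node (se Q) a R)) (sym (repl-without-lT (se P) (proj₂ (PF-monochrome p))))
      (monochrome-node (PF-monochrome q) (PF-monochrome p))

  ℓ-bicoloured : ∀ {P} → IsPℓ A P → Bicoloured (se P)
  ℓ-bicoloured (pos {a} {P} {Q} p q) =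
    subst (λ L → Bicoloured (node L a (se Q))) (sym (repl-without-lF (se P) (proj₂ (PT-monochrome p))))
      (bicoloured (PT-monochrome p) (PF-monochrome q))
  ℓ-bicoloured (neg {a} {P} {Q} p q) =
    subst (λ R → Bicoloured (node (se Q) a R)) (sym (repl-without-lF (se P) (proj₂ (PT-monochrome p))))
      (bicoloured (PF-monochrome q) (PT-monochrome p))

  *-both : ∀ {P} → IsP* A P → HasBoth (se P)
  c-both : ∀ {P} → IsPc A P → HasBoth (se P)
  d-both : ∀ {P} → IsPd A P → HasBoth (se P)
  *-both (c p) = c-both p
  *-both (d p) = d-both p
  c-both (ℓ p) = bicoloured-both (ℓ-bicoloured p)
  c-both (and {P} {Q} p q) = subst HasBoth (sym (se-∧ P Q)) (graft-both (*-both p) (d-both q))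
  d-both (ℓ p) = bicoloured-both (ℓ-bicoloured p)
  d-both (or {P} {Q} p q) = subst HasBoth (sym (se-∨ P Q)) (graft-both (*-both p) (c-both q))

  *-rigid : ∀ {P} → IsP* A P → ∃ λ u → Rigid u (se P)
  c-rigid : ∀ {P} → IsPc A P → Rigid lF (se P)
  d-rigid : ∀ {P} → IsPd A P → Rigid lT (se P)
  *-rigid (c p) = lF , c-rigid p
  *-rigid (d p) = lT , d-rigid p
  c-rigid (ℓ p) = bicoloured-rigid (ℓ-bicoloured p) lF
  c-rigid (and {P} {Q} p q) =
    subst (Rigid lF) (sym (se-∧ P Q)) (rigid-graft lT (proj₂ (*-rigid p)) (*-both p) (d-both q))
  d-rigid (ℓ p) = bicoloured-rigid (ℓ-bicoloured p) lT
  d-rigid (or {P} {Q} p q) =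
    subst (Rigid lT) (sym (se-∨ P Q)) (rigid-graft lF (proj₂ (*-rigid p)) (*-both p) (c-both q))

theorem3p7 : (A : Set) → (a₀ : A) →
    (∀ (P Q : Term A) → IsP* A P → IsPd A Q →
       UniqueCD (se (P `∧ Q)) (T↦△ (se P)) (se Q) × NoDD (se (P `∧ Q)))
    × (∀ (P Q : Term A) → IsP* A P → IsPc A Q →
       NoCD (se (P `∨ Q)) × UniqueDD (se (P `∨ Q)) (F↦△ (se P)) (se Q))
theorem3p7 A _ = conjunction , disjunction
  where
  conjunction : ∀ (P Q : Term A) → IsP* A P → IsPd A Q →
                UniqueCD (se (P `∧ Q)) (T↦△ (se P)) (se Q) × NoDD (se (P `∧ Q))
  conjunction P Q p q =
    subst₂ (λ X Y → UniqueDecomposition lT X Y (se Q)) (sym (se-∧ P Q)) (sym (T↦△-hole (se P)))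
      (graft-unique-decomposition (*-both p) (d-both q) (d-rigid q)) ,
    subst (NoDecomposition lF) (sym (se-∧ P Q))
      (graft-no-other-decomposition (*-both p) (d-both q) (d-rigid q))

  disjunction : ∀ (P Q : Term A) → IsP* A P → IsPc A Q →
                NoCD (se (P `∨ Q)) × UniqueDD (se (P `∨ Q)) (F↦△ (se P)) (se Q)
  disjunction P Q p q =
    subst (NoDecomposition lT) (sym (se-∨ P Q))
      (graft-no-other-decomposition (*-both p) (c-both q) (c-rigid q)) ,
    subst₂ (λ X Y → UniqueDecomposition lF X Y (se Q)) (sym (se-∨ P Q)) (sym (F↦△-hole (se P)))
      (graft-unique-decomposition (*-both p) (c-both q) (c-rigid q))
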